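{- Let $n \equiv 1$ or $5 \pmod 6$, $v=2n+2$, and $g \in \mathbb{Z}_n$. Consider the ${\rm TS}(v,4)$ with block set $\mathcal{S}_g \cup \mathcal{S}_{g+1}$ from Schreiber's construction (for any choice of red/blue colorings). Let $G_g \cup G_{g+1}$ be the subgraph of its $2$-block intersection graph induced by the blocks of $\mathcal{S}_g$ and $\mathcal{S}_{g+1}$ arising in Steps 1c, 2a, 2b and 3. Then $G_g \cup G_{g+1}$ is connected.
   Context: Schreiber's construction: let $n\equiv 1$ or $5 \pmod 6$, $v=2n+2$, point set $(\mathbb{Z}_n\times\mathbb{Z}_2)\cup\{\infty_0,\infty_1\}$. For $g\in\mathbb{Z}_n$ let $D_g'$ be the digraph on $\mathbb{Z}_n$ with arc set $\{(h+g,-2h+g): h\in\mathbb{Z}_n, h\ne 0\}$; the arcs $(h+g,-2h+g)$ and $(-h+g,2h+g)$ are called opposite, and for each pair of opposite arcs one is (arbitrarily) colored red and the other blue. The block set $\mathcal{S}_g$ consists of: (1a) $\{(x,0),(y,0),(z,0)\}$ for distinct $x,y,z\in\mathbb{Z}_n$ with $x+y+z\equiv 3g \pmod n$; (1b) for each such triple, the seven triples $\{(x,\varepsilon_1),(y,\varepsilon_2),(z,\varepsilon_3)\}$ with $(\varepsilon_1,\varepsilon_2,\varepsilon_3)\in\{0,1\}^3\setminus\{(0,0,0)\}$; (1c) for each arc $(a,b)$ of $D_g'$, the blocks $\{(a,0),(b,0),(a,1)\}$ and $\{(a,0),(b,1),(a,1)\}$; (2a) for each red arc $(a,b)$, the blocks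 $\{\infty_0,(a,0),(b,0)\}$, $\{\infty_0,(a,1),(b,1)\}$, $\{\infty_1,(a,0),(b,1)\}$, $\{\infty_1,(a,1),(b,0)\}$; (2b) for each blue arc $(a,b)$, the same four blocks with $\infty_0$ and $\infty_1$ interchanged; (3) $\{\infty_0,\infty_1,(g,0)\}$, $\{\infty_0,\infty_1,(g,1)\}$, $\{\infty_0,(g,0),(g,1)\}$, $\{\infty_1,(g,0),(g,1)\}$. Each $\mathcal{S}_g$ is a ${\rm TS}(v,2)$ and distinct $\mathcal{S}_g$ are disjoint, so a union of $t$ of them is a simple ${\rm TS}(v,2t)$. The $2$-block intersection graph has the blocks as vertices, two blocks adjacent if they share exactly two points. -}

module Defs where

open import Data.Nat using (ℕ; zero; suc; _+_; _∸_; NonZero)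
open import Data.Nat.DivMod using (_mod_)
open import Data.Fin using (Fin; toℕ)
open import Data.Bool using (Bool; true; false; if_then_else_)
open import Data.Product using (_×_; _,_)
open import Data.Sum using (_⊎_)
open import Relation.Binary.PropositionalEquality using (_≡_; _≢_; refl; cong)
open import Relation.Nullary using (Dec; yes; no; does)
import Data.Fin.Properties as FinP
import Data.Bool.Properties as BoolP

module _ {n : ℕ} .{{_ : NonZero n}} where
  _⊕_ : Fin n → Fin n → Fin n
  a ⊕ b = (toℕ a + toℕ b) mod n

  ⊖_ : Fin n → Fin n
  ⊖ a = (n ∸ toℕ a) mod n

  one : Fin n
  one = 1 mod n

-- Points: (Z_n × Z_2) ∪ {∞₀, ∞₁};  Z_2 = Bool with false = 0, true = 1.
data Point (n : ℕ) : Set where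
  pt  : Fin n → Bool → Point n
  inf : Bool → Point n      -- inf false = ∞₀, inf true = ∞₁

_≟P_ : {n : ℕ} → (x y : Point n) → Dec (x ≡ y)
pt a e ≟P pt b f with a FinP.≟ b | e BoolP.≟ f
... | yes refl | yes refl = yes refl
... | no p | _ = no λ { refl → p refl }
... | yes _ | no q = no λ { refl → q refl }
pt _ _ ≟P inf _ = no λ ()
inf _ ≟P pt _ _ = no λ ()
inf e ≟P inf f with e BoolP.≟ f
... | yes refl = yes refl
... | no q = no λ { refl → q refl }

Block : ℕ → Set
Block n = Point n × Point n × Point n

_∈?_ : {n : ℕ} → Point n → Block n → Bool
p ∈? (x , y , z) = does (p ≟P x) Data.Bool.∨ (does (p ≟P y) Data.Bool.∨ does (p ≟P z))

ind : Bool → ℕ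
ind b = if b then 1 else 0

-- number of points in common of two blocks (blocks have distinct points)
common : {n : ℕ} → Block n → Block n → ℕ
common (x , y , z) B = ind (x ∈? B) + ind (y ∈? B) + ind (z ∈? B)

Adjacent : {n : ℕ} → Block n → Block n → Set
Adjacent B B' = common B B' ≡ 2

-- The arc indexed by h ≠ 0 is
-- (h+g, -2h+g); its opposite arc is the one indexed by -h.
-- colour h ≡ true means the arc indexed by h is red, false means blue.
ValidColouring : {n : ℕ} .{{_ : NonZero n}} → (Fin n → Bool) → Set
ValidColouring {n} c = (h : Fin n) → toℕ h ≢ 0 → c h ≢ c (⊖ h)

module _ {n : ℕ} .{{_ : NonZero n}} where
  tail : Fin n → Fin n → Fin n
  tail g h = h ⊕ g
  head : Fin n → Fin n → Fin n
  head g h = (⊖ (h ⊕ h)) ⊕ g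

  data SBlock (c : Fin n → Bool) (g : Fin n) : Block n → Set where
    s1c-i  : (h : Fin n) → toℕ h ≢ 0 →
             SBlock c g (pt (tail g h) false , pt (head g h) false , pt (tail g h) true)
    s1c-ii : (h : Fin n) → toℕ h ≢ 0 →
             SBlock c g (pt (tail g h) false , pt (head g h) true , pt (tail g h) true)
    s2a-1 : (h : Fin n) → toℕ h ≢ 0 → c h ≡ true →
            SBlock c g (inf false , pt (tail g h) false , pt (head g h) false)
    s2a-2 : (h : Fin n) → toℕ h ≢ 0 → c h ≡ true →
            SBlock c g (inf false , pt (tail g h) true , pt (head g h) true)
    s2a-3 : (h : Fin n) → toℕ h ≢ 0 → c h ≡ true →
            SBlock c g (inf true , pt (tail g h) false , pt (head g h) true)
    s2a-4 : (h : Fin n) → toℕ h ≢ 0 → c h ≡ true →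
            SBlock c g (inf true , pt (tail g h) true , pt (head g h) false)
    s2b-1 : (h : Fin n) → toℕ h ≢ 0 → c h ≡ false →
            SBlock c g (inf true , pt (tail g h) false , pt (head g h) false)
    s2b-2 : (h : Fin n) → toℕ h ≢ 0 → c h ≡ false →
            SBlock c g (inf true , pt (tail g h) true , pt (head g h) true)
    s2b-3 : (h : Fin n) → toℕ h ≢ 0 → c h ≡ false →
            SBlock c g (inf false , pt (tail g h) false , pt (head g h) true)
    s2b-4 : (h : Fin n) → toℕ h ≢ 0 → c h ≡ false →
            SBlock c g (inf false , pt (tail g h) true , pt (head g h) false)
    s3-1 : SBlock c g (inf false , inf true , pt g false)
    s3-2 : SBlock c g (inf false , inf true , pt g true)
    s3-3 : SBlock c g (inf false , pt g false , pt g true)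
    s3-4 : SBlock c g (inf true , pt g false , pt g true)

data Walk {n : ℕ} (V : Block n → Set) : Block n → Block n → Set where
  stop : {B : Block n} → Walk V B B
  step : {B B₁ B₂ : Block n} → V B₁ → Adjacent B B₁ → Walk V B₁ B₂ → Walk V B B₂

Connected : {n : ℕ} → (Block n → Set) → Set
Connected {n} V = (B B' : Block n) → V B → V B' → Walk V B B'

-- Fix b ∈ {g, g + 1} and an arc h ≠ 0 of D′_b, with tail t = h + b and head d = −2h + b.
-- Its two Step 1c blocks share (t,0) and (t,1), and each of its four Step 2 blocks
-- {∞ₓ, (t,e), (d,f)} shares two points with the Step 1c block containing (d,f); so, whatever
-- the colouring, the six blocks of an arc lie in one component.  Arcs are joined through
-- their ∞₀-blocks: the head of arc h of D′_b is the tail of arc −2h, and arc p of D′_g and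
-- arc p − 1 of D′_{g+1} have the same tail p + g.  With q = −r/2 this links arc r of D′_g to
-- arc q, then to arc q − 1 of D′_{g+1}, to arc −2(q − 1) = r + 2, and back to arc r + 3 of D′_g.
-- As 3 is invertible mod n, stepping by 3 from arc −1 of D′_{g+1}, whose tail is g, reaches
-- every arc.  The Step 3 blocks of b are adjacent to {∞₀, ∞₁, (b,0)}, and both that block and
-- the ∞₀-block of arc −1 of D′_{g+1} are adjacent (or equal) to {∞₀, ∞₁, (g,0)}.
-- Invertibility of 3 also gives t ≠ d, so the points of every block are distinct and sharing
-- two points is a symmetric relation.

module Submission where

open import Data.Bool using (Bool; true; false)
open import Data.Bool.Properties using (∨-zeroʳ)
open import Data.Empty using (⊥-elim)
open import Data.Fin using (Fin; toℕ) renaming (zero to fz)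
open import Data.Fin.Properties using (toℕ-injective; toℕ<n; toℕ-fromℕ<; _≟_)
open import Data.List using ([]; _∷_)
open import Data.Nat using (ℕ; NonZero; zero; suc; _+_; _*_; _∸_; _%_) renaming (_≟_ to _≟ℕ_)
open import Data.Nat.DivMod using (_mod_; _/_; m≡m%n+[m/n]*n; m%n%n≡m%n; [m+kn]%n≡m%n; %-distribˡ-+; %-distribˡ-*; m<n⇒m%n≡m; n%n≡0)
open import Data.Nat.Properties using (m∸n+n≡m; <⇒≤; *-suc; +-assoc; +-identityʳ; *-assoc; *-identityˡ; *-zeroʳ)
open import Data.Nat.Tactic.RingSolver using (solve-∀; solve)
open import Data.Product using (Σ; _×_; _,_; proj₁; proj₂)
open import Data.Sum using (_⊎_; inj₁; inj₂)
open import Function.Bundles using (_⇔_; mk⇔; Equivalence)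
open import Function.Properties.Equivalence using () renaming (trans to ⇔-trans; sym to ⇔-sym)
open import Relation.Binary.Bundles using (Setoid)
open import Relation.Binary.PropositionalEquality using (_≡_; _≢_; refl; sym; trans; cong; cong₂; subst; ≢-sym)
import Relation.Binary.Reasoning.Setoid as SetoidReasoning
open import Relation.Nullary using (¬_; yes; no; does)
open import Relation.Nullary.Decidable using (dec-true; dec-false)

open import Defs

module Modular (m : ℕ) where
  N : ℕ
  N = suc m

  infix 4 _≋_
  record _≋_ (a b : ℕ) : Set where
    constructor mod-eq
    field mod-≡ : a % N ≡ b % N

  ≋-setoid : Setoid _ _
  ≋-setoid = record
    { Carrier = ℕ ; _≈_ = _≋_
    ; isEquivalence = record
      { refl = mod-eq refl
      ; sym = λ (mod-eq p) → mod-eq (sym p)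
      ; trans = λ (mod-eq p) (mod-eq q) → mod-eq (trans p q) } }

  open Setoid ≋-setoid public using () renaming (refl to ≋-refl; sym to ≋-sym; trans to ≋-trans)
  open SetoidReasoning ≋-setoid

  ≡⇒≋ : ∀ {a b} → a ≡ b → a ≋ b
  ≡⇒≋ refl = ≋-refl

  %-≋ : ∀ a → a % N ≋ a
  %-≋ a = mod-eq (m%n%n≡m%n a N)

  +-cong : ∀ {a b c d} → a ≋ b → c ≋ d → a + c ≋ b + d
  +-cong {a} {b} {c} {d} (mod-eq p) (mod-eq q) = mod-eq
    (trans (%-distribˡ-+ a c N) (trans (cong₂ (λ x y → (x + y) % N) p q) (sym (%-distribˡ-+ b d N))))

  *-cong : ∀ {a b c d} → a ≋ b → c ≋ d → a * c ≋ b * d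
  *-cong {a} {b} {c} {d} (mod-eq p) (mod-eq q) = mod-eq
    (trans (%-distribˡ-* a c N) (trans (cong₂ (λ x y → (x * y) % N) p q) (sym (%-distribˡ-* b d N))))

  +-congˡ : ∀ {a b} c → a ≋ b → c + a ≋ c + b
  +-congˡ c = +-cong (≋-refl {c})

  +-congʳ : ∀ {a b} c → a ≋ b → a + c ≋ b + c
  +-congʳ c p = +-cong p (≋-refl {c})

  *-congˡ : ∀ {a b} c → a ≋ b → c * a ≋ c * b
  *-congˡ c = *-cong (≋-refl {c})

  +-multiple : ∀ a k → a + k * N ≋ a
  +-multiple a k = mod-eq ([m+kn]%n≡m%n a k N)

  +-cancelʳ : ∀ {a b} c → a + c ≋ b + c → a ≋ b
  +-cancelʳ {a} {b} c p = begin
    a                ≈⟨ +-multiple a c ⟨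
    a + c * N        ≡⟨ +-suc-multiple a c ⟩
    (a + c) + c * m  ≈⟨ +-congʳ (c * m) p ⟩
    (b + c) + c * m  ≡⟨ +-suc-multiple b c ⟨
    b + c * N        ≈⟨ +-multiple b c ⟩
    b                ∎

    where
    +-suc-multiple : ∀ x y → x + y * N ≡ (x + y) + y * m
    +-suc-multiple x y = trans (cong (x +_) (*-suc y m)) (sym (+-assoc x y (y * m)))

  unit-cancel : ∀ u v a → u * v ≋ 1 → u * a ≋ 0 → a ≋ 0
  unit-cancel u v a uv≋1 ua≋0 = begin
    a            ≡⟨ solve (a ∷ []) ⟩
    a * 1        ≈⟨ *-congˡ a uv≋1 ⟨
    a * (u * v)  ≡⟨ solve (a ∷ u ∷ v ∷ []) ⟩
    v * (u * a)  ≈⟨ *-congˡ v ua≋0 ⟩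
    v * 0        ≡⟨ solve (v ∷ []) ⟩
    0            ∎

  toℕ-mod : ∀ a → toℕ (a mod N) ≋ a
  toℕ-mod a = ≋-trans (≡⇒≋ (toℕ-fromℕ< _)) (%-≋ a)

  toℕ%N : (x : Fin N) → toℕ x % N ≡ toℕ x
  toℕ%N x = m<n⇒m%n≡m (toℕ<n x)

  toℕ-≋-injective : {x y : Fin N} → toℕ x ≋ toℕ y → x ≡ y
  toℕ-≋-injective {x} {y} (mod-eq p) = toℕ-injective (trans (sym (toℕ%N x)) (trans p (toℕ%N y)))

  toℕ≋0⇒≡0 : {x : Fin N} → toℕ x ≋ 0 → toℕ x ≡ 0
  toℕ≋0⇒≡0 {x} (mod-eq p) = trans (sym (toℕ%N x)) p

  toℕ-⊕ : (x y : Fin N) → toℕ (x ⊕ y) ≋ toℕ x + toℕ y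
  toℕ-⊕ x y = toℕ-mod (toℕ x + toℕ y)

  toℕ-⊖ : (x : Fin N) → toℕ (⊖ x) + toℕ x ≋ 0
  toℕ-⊖ x = begin
    toℕ (⊖ x) + toℕ x    ≈⟨ +-congʳ (toℕ x) (toℕ-mod (N ∸ toℕ x)) ⟩
    (N ∸ toℕ x) + toℕ x  ≡⟨ m∸n+n≡m (<⇒≤ (toℕ<n x)) ⟩
    N                    ≈⟨ mod-eq (n%n≡0 N) ⟩
    0                    ∎

  toℕ-one : toℕ (one {N}) ≋ 1
  toℕ-one = toℕ-mod 1

  stride-induction : (P : Fin N → Set) (s : Fin N) (k : ℕ) → toℕ s * k ≋ 1 →
                     P fz → (∀ x → P x → P (x ⊕ s)) → ∀ x → P x
  stride-induction P s k sk≋1 P0 Ps x = subst P (toℕ-≋-injective multiple≋x) (multiples (k * toℕ x))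
    where
    multiples : ∀ i → P ((toℕ s * i) mod N)
    multiples zero =
      subst P (toℕ-≋-injective (≋-sym (≋-trans (toℕ-mod (toℕ s * 0)) (≡⇒≋ (*-zeroʳ (toℕ s)))))) P0
    multiples (suc i) = subst P (toℕ-≋-injective (begin
      toℕ (((toℕ s * i) mod N) ⊕ s)  ≈⟨ toℕ-⊕ _ s ⟩
      toℕ ((toℕ s * i) mod N) + toℕ s ≈⟨ +-congʳ (toℕ s) (toℕ-mod (toℕ s * i)) ⟩
      toℕ s * i + toℕ s              ≡⟨ lemma (toℕ s) i ⟩
      toℕ s * suc i                  ≈⟨ toℕ-mod (toℕ s * suc i) ⟨
      toℕ ((toℕ s * suc i) mod N)    ∎)) (Ps _ (multiples i))
      where
      lemma : ∀ a i → a * i + a ≡ a * suc i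
      lemma = solve-∀
    multiple≋x : toℕ ((toℕ s * (k * toℕ x)) mod N) ≋ toℕ x
    multiple≋x = begin
      toℕ ((toℕ s * (k * toℕ x)) mod N)  ≈⟨ toℕ-mod _ ⟩
      toℕ s * (k * toℕ x)                ≡⟨ *-assoc (toℕ s) k (toℕ x) ⟨
      (toℕ s * k) * toℕ x                ≈⟨ *-cong sk≋1 (≋-refl {toℕ x}) ⟩
      1 * toℕ x                          ≡⟨ *-identityˡ (toℕ x) ⟩
      toℕ x                              ∎

  3-invertible×odd : N % 6 ≡ 1 ⊎ N % 6 ≡ 5 → Σ ℕ (λ K → 3 * K ≋ 1) × Σ ℕ (λ J → N ≡ 2 * J + 1)
  3-invertible×odd (inj₁ N%6≡1) = units (N / 6) (trans (m≡m%n+[m/n]*n N 6) (cong (_+ N / 6 * 6) N%6≡1))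
    where
    units : ∀ a → N ≡ 1 + a * 6 → Σ ℕ (λ K → 3 * K ≋ 1) × Σ ℕ (λ J → N ≡ 2 * J + 1)
    units a N≡1+a*6 = (4 * a + 1 , 3*K≋1) , (3 * a , trans N≡1+a*6 (solve (a ∷ [])))
      where
      3*K≋1 : 3 * (4 * a + 1) ≋ 1
      3*K≋1 = begin
        3 * (4 * a + 1)      ≡⟨ solve (a ∷ []) ⟩
        1 + 2 * (1 + a * 6)  ≡⟨ cong (λ x → 1 + 2 * x) N≡1+a*6 ⟨
        1 + 2 * N            ≈⟨ +-multiple 1 2 ⟩
        1                    ∎
  3-invertible×odd (inj₂ N%6≡5) = units (N / 6) (trans (m≡m%n+[m/n]*n N 6) (cong (_+ N / 6 * 6) N%6≡5))
    where
    units : ∀ a → N ≡ 5 + a * 6 → Σ ℕ (λ K → 3 * K ≋ 1) × Σ ℕ (λ J → N ≡ 2 * J + 1)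
    units a N≡5+a*6 = (2 * a + 2 , 3*K≋1) , (3 * a + 2 , trans N≡5+a*6 (solve (a ∷ [])))
      where
      3*K≋1 : 3 * (2 * a + 2) ≋ 1
      3*K≋1 = begin
        3 * (2 * a + 2)      ≡⟨ solve (a ∷ []) ⟩
        1 + 1 * (5 + a * 6)  ≡⟨ cong (λ x → 1 + 1 * x) N≡5+a*6 ⟨
        1 + 1 * N            ≈⟨ +-multiple 1 1 ⟩
        1                    ∎

  module CoprimeToSix {K J : ℕ} (3*K≋1 : 3 * K ≋ 1) (N≡2*J+1 : N ≡ 2 * J + 1) where
    2*[J+1]≋1 : 2 * (J + 1) ≋ 1
    2*[J+1]≋1 = begin
      2 * (J + 1)          ≡⟨ solve (J ∷ []) ⟩
      1 + 1 * (2 * J + 1)  ≡⟨ cong (λ x → 1 + 1 * x) N≡2*J+1 ⟨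
      1 + 1 * N            ≈⟨ +-multiple 1 1 ⟩
      1                    ∎

    3*≢0 : {h : Fin N} → toℕ h ≢ 0 → ¬ (3 * toℕ h ≋ 0)
    3*≢0 {h} h≢0 3h≋0 = h≢0 (toℕ≋0⇒≡0 (unit-cancel 3 K (toℕ h) 3*K≋1 3h≋0))

    2*≢0 : {h : Fin N} → toℕ h ≢ 0 → ¬ (2 * toℕ h ≋ 0)
    2*≢0 {h} h≢0 2h≋0 = h≢0 (toℕ≋0⇒≡0 (unit-cancel 2 (J + 1) (toℕ h) 2*[J+1]≋1 2h≋0))

    −2·_ : Fin N → Fin N
    −2· h = ⊖ (h ⊕ h)

    _⊖1 : Fin N → Fin N
    x ⊖1 = x ⊕ (⊖ one)

    three : Fin N
    three = 3 mod N

    toℕ-−2· : (h : Fin N) → toℕ (−2· h) + 2 * toℕ h ≋ 0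
    toℕ-−2· h = begin
      toℕ (−2· h) + 2 * toℕ h        ≡⟨ cong (toℕ (−2· h) +_) (2*a≡a+a (toℕ h)) ⟩
      toℕ (−2· h) + (toℕ h + toℕ h)  ≈⟨ +-congˡ (toℕ (−2· h)) (toℕ-⊕ h h) ⟨
      toℕ (−2· h) + toℕ (h ⊕ h)      ≈⟨ toℕ-⊖ (h ⊕ h) ⟩
      0                              ∎
      where
      2*a≡a+a : ∀ a → 2 * a ≡ a + a
      2*a≡a+a = solve-∀

    toℕ-⊖1 : (x : Fin N) → toℕ (x ⊖1) + 1 ≋ toℕ x
    toℕ-⊖1 x = begin
      toℕ (x ⊖1) + 1                         ≈⟨ +-cong (toℕ-⊕ x (⊖ one)) (≋-sym toℕ-one) ⟩
      (toℕ x + toℕ (⊖ one {N})) + toℕ (one {N})  ≡⟨ +-assoc (toℕ x) _ _ ⟩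
      toℕ x + (toℕ (⊖ one {N}) + toℕ (one {N}))  ≈⟨ +-congˡ (toℕ x) (toℕ-⊖ one) ⟩
      toℕ x + 0                              ≡⟨ +-identityʳ (toℕ x) ⟩
      toℕ x                                  ∎

    toℕ-⊕one : (x : Fin N) → toℕ (x ⊕ one) ≋ toℕ x + 1
    toℕ-⊕one x = ≋-trans (toℕ-⊕ x one) (+-congˡ (toℕ x) toℕ-one)

    toℕ-⊕three : (x : Fin N) → toℕ (x ⊕ three) ≋ toℕ x + 3
    toℕ-⊕three x = ≋-trans (toℕ-⊕ x three) (+-congˡ (toℕ x) (toℕ-mod 3))

    ⊕one⊖1 : (x : Fin N) → (x ⊕ one) ⊖1 ≡ x
    ⊕one⊖1 x = toℕ-≋-injective (+-cancelʳ 1 (≋-trans (toℕ-⊖1 (x ⊕ one)) (toℕ-⊕one x)))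

    one⊖1≡0 : toℕ (one ⊖1) ≡ 0
    one⊖1≡0 = toℕ≋0⇒≡0 (+-cancelʳ 1 (≋-trans (toℕ-⊖1 one) toℕ-one))

    ⊖1≡0⇒≡one : {x : Fin N} → toℕ (x ⊖1) ≡ 0 → x ≡ one
    ⊖1≡0⇒≡one {x} x⊖1≡0 = toℕ-≋-injective (begin
      toℕ x           ≈⟨ toℕ-⊖1 x ⟨
      toℕ (x ⊖1) + 1  ≡⟨ cong (_+ 1) x⊖1≡0 ⟩
      1               ≈⟨ toℕ-one ⟨
      toℕ one         ∎)

    −2·-unique : (h : Fin N) {x : Fin N} → toℕ x + 2 * toℕ h ≋ 0 → −2· h ≡ x
    −2·-unique h x+2h≋0 = toℕ-≋-injective (+-cancelʳ (2 * toℕ h) (≋-trans (toℕ-−2· h) (≋-sym x+2h≋0)))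

    −2·-≡0 : {h : Fin N} → toℕ h ≡ 0 → toℕ (−2· h) ≡ 0
    −2·-≡0 {h} h≡0 = cong toℕ (−2·-unique h {x = fz} (≡⇒≋ (cong (2 *_) h≡0)))

    −2·≢0⇒≢0 : {h : Fin N} → toℕ (−2· h) ≢ 0 → toℕ h ≢ 0
    −2·≢0⇒≢0 −2h≢0 h≡0 = −2h≢0 (−2·-≡0 h≡0)

    −2·-≢0 : {h : Fin N} → toℕ h ≢ 0 → toℕ (−2· h) ≢ 0
    −2·-≢0 {h} h≢0 −2h≡0 = 2*≢0 h≢0 (begin
      2 * toℕ h                ≡⟨ cong (_+ 2 * toℕ h) −2h≡0 ⟨
      toℕ (−2· h) + 2 * toℕ h  ≈⟨ toℕ-−2· h ⟩
      0                        ∎)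

    -- 2J ≡ −1, so multiplying by J divides by −2.
    −½·_ : Fin N → Fin N
    −½· r = (toℕ r * J) mod N

    −2·−½· : (r : Fin N) → −2· (−½· r) ≡ r
    −2·−½· r = −2·-unique (−½· r) (begin
      toℕ r + 2 * toℕ (−½· r)   ≈⟨ +-congˡ (toℕ r) (*-congˡ 2 (toℕ-mod (toℕ r * J))) ⟩
      toℕ r + 2 * (toℕ r * J)   ≡⟨ r+2rj≡r[2j+1] (toℕ r) J ⟩
      toℕ r * (2 * J + 1)       ≡⟨ cong (toℕ r *_) N≡2*J+1 ⟨
      0 + toℕ r * N             ≈⟨ +-multiple 0 (toℕ r) ⟩
      0                         ∎)
      where
      r+2rj≡r[2j+1] : ∀ r j → r + 2 * (r * j) ≡ r * (2 * j + 1)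
      r+2rj≡r[2j+1] = solve-∀

    −2·-⊖1 : (q : Fin N) → −2· (q ⊖1) ≡ ((−2· q) ⊕ three) ⊖1
    −2·-⊖1 q = −2·-unique (q ⊖1) (+-cancelʳ 3 (begin
      (X + 2 * K′) + 3                  ≡⟨ rearrange₁ X K′ ⟩
      (X + 1) + 2 * (K′ + 1)            ≈⟨ +-cong (toℕ-⊖1 ((−2· q) ⊕ three)) (*-congˡ 2 (toℕ-⊖1 q)) ⟩
      toℕ ((−2· q) ⊕ three) + 2 * toℕ q ≈⟨ +-congʳ (2 * toℕ q) (toℕ-⊕three (−2· q)) ⟩
      (U + 3) + 2 * toℕ q               ≡⟨ rearrange₂ U (toℕ q) ⟩
      (U + 2 * toℕ q) + 3               ≈⟨ +-congʳ 3 (toℕ-−2· q) ⟩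
      3                                 ∎))
      where
      X = toℕ (((−2· q) ⊕ three) ⊖1)
      K′ = toℕ (q ⊖1)
      U = toℕ (−2· q)
      rearrange₁ : ∀ x k → (x + 2 * k) + 3 ≡ (x + 1) + 2 * (k + 1)
      rearrange₁ = solve-∀
      rearrange₂ : ∀ u a → (u + 3) + 2 * a ≡ (u + 2 * a) + 3
      rearrange₂ = solve-∀

    −2·one⊕three : (−2· one) ⊕ three ≡ one
    −2·one⊕three = toℕ-≋-injective (begin
      toℕ ((−2· one) ⊕ three)        ≈⟨ toℕ-⊕three (−2· one) ⟩
      U + 3                          ≡⟨ rearrange U ⟩
      (U + 2 * 1) + 1                ≈⟨ +-congʳ 1 (+-congˡ U (*-congˡ 2 toℕ-one)) ⟨
      (U + 2 * toℕ (one {N})) + 1    ≈⟨ +-congʳ 1 (toℕ-−2· one) ⟩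
      1                              ≈⟨ toℕ-one ⟨
      toℕ one                        ∎)
      where
      U = toℕ (−2· one {N})
      rearrange : ∀ u → u + 3 ≡ (u + 2 * 1) + 1
      rearrange = solve-∀

    toℕ-head : (b h : Fin N) → toℕ (head b h) + 2 * toℕ h ≋ toℕ b
    toℕ-head b h = begin
      toℕ (head b h) + 2 * toℕ h         ≈⟨ +-congʳ (2 * toℕ h) (toℕ-⊕ (−2· h) b) ⟩
      (toℕ (−2· h) + toℕ b) + 2 * toℕ h  ≡⟨ +-rightComm (toℕ (−2· h)) (toℕ b) (2 * toℕ h) ⟩
      (toℕ (−2· h) + 2 * toℕ h) + toℕ b  ≈⟨ +-congʳ (toℕ b) (toℕ-−2· h) ⟩
      toℕ b                              ∎
      where
      +-rightComm : ∀ x y z → (x + y) + z ≡ (x + z) + y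
      +-rightComm = solve-∀

    tail≡head⇒ : (b h k : Fin N) → tail b h ≡ head b k → toℕ h + 2 * toℕ k ≋ 0
    tail≡head⇒ b h k t≡d = +-cancelʳ (toℕ b) (begin
      (toℕ h + 2 * toℕ k) + toℕ b  ≡⟨ +-rightComm (toℕ h) (2 * toℕ k) (toℕ b) ⟩
      (toℕ h + toℕ b) + 2 * toℕ k  ≈⟨ +-congʳ (2 * toℕ k) (toℕ-⊕ h b) ⟨
      toℕ (tail b h) + 2 * toℕ k   ≡⟨ cong (λ x → toℕ x + 2 * toℕ k) t≡d ⟩
      toℕ (head b k) + 2 * toℕ k   ≈⟨ toℕ-head b k ⟩
      toℕ b                        ∎)
      where
      +-rightComm : ∀ x y z → (x + y) + z ≡ (x + z) + y
      +-rightComm = solve-∀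

    tail≢head : (b : Fin N) {h : Fin N} → toℕ h ≢ 0 → tail b h ≢ head b h
    tail≢head b {h} h≢0 t≡d =
      3*≢0 h≢0 (≋-trans (≡⇒≋ (3*a≡a+2*a (toℕ h))) (tail≡head⇒ b h h t≡d))
      where
      3*a≡a+2*a : ∀ a → 3 * a ≡ a + 2 * a
      3*a≡a+2*a = solve-∀

    tail≢head-−2· : (b : Fin N) {h : Fin N} → toℕ h ≢ 0 → tail b h ≢ head b (−2· h)
    tail≢head-−2· b {h} h≢0 t≡d = 3*≢0 h≢0 (+-cancelʳ (H + 2 * U) (begin
      3 * H + (H + 2 * U)  ≡⟨ rearrange H U ⟩
      2 * (U + 2 * H)      ≈⟨ *-congˡ 2 (toℕ-−2· h) ⟩
      0                    ≈⟨ tail≡head⇒ b h (−2· h) t≡d ⟨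
      H + 2 * U            ∎))
      where
      H = toℕ h
      U = toℕ (−2· h)
      rearrange : ∀ a u → 3 * a + (a + 2 * u) ≡ 2 * (u + 2 * a)
      rearrange = solve-∀

    tail-⊕one-⊖1 : (b p : Fin N) → tail (b ⊕ one) (p ⊖1) ≡ tail b p
    tail-⊕one-⊖1 b p = toℕ-≋-injective (begin
      toℕ (tail (b ⊕ one) (p ⊖1))  ≈⟨ toℕ-⊕ (p ⊖1) (b ⊕ one) ⟩
      toℕ (p ⊖1) + toℕ (b ⊕ one)   ≈⟨ +-congˡ (toℕ (p ⊖1)) (toℕ-⊕one b) ⟩
      toℕ (p ⊖1) + (toℕ b + 1)     ≡⟨ rearrange (toℕ (p ⊖1)) (toℕ b) ⟩
      (toℕ (p ⊖1) + 1) + toℕ b     ≈⟨ +-congʳ (toℕ b) (toℕ-⊖1 p) ⟩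
      toℕ p + toℕ b                ≈⟨ toℕ-⊕ p b ⟨
      toℕ (tail b p)               ∎)
      where
      rearrange : ∀ k a → k + (a + 1) ≡ (k + 1) + a
      rearrange = solve-∀

    head≢head-⊕one-⊖1 : (b : Fin N) {p : Fin N} → toℕ p ≢ 0 → head b p ≢ head (b ⊕ one) (p ⊖1)
    head≢head-⊕one-⊖1 b {p} p≢0 d≡d′ = 3*≢0 p≢0 (*-cong 3≋0 (≋-refl {toℕ p}))
      where
      D = toℕ (head b p)
      K′ = toℕ (p ⊖1)
      rearrange₁ : ∀ x k → x + 2 * (k + 1) ≡ 2 + (x + 2 * k)
      rearrange₁ = solve-∀
      rearrange₂ : ∀ a → 2 + (a + 1) ≡ 3 + a
      rearrange₂ = solve-∀
      3≋0 : 3 ≋ 0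
      3≋0 = ≋-sym (+-cancelʳ (toℕ b) (begin
        toℕ b                                     ≈⟨ toℕ-head b p ⟨
        D + 2 * toℕ p                             ≈⟨ +-congˡ D (*-congˡ 2 (toℕ-⊖1 p)) ⟨
        D + 2 * (K′ + 1)                          ≡⟨ rearrange₁ D K′ ⟩
        2 + (D + 2 * K′)                          ≡⟨ cong (λ d → 2 + (toℕ d + 2 * K′)) d≡d′ ⟩
        2 + (toℕ (head (b ⊕ one) (p ⊖1)) + 2 * K′) ≈⟨ +-congˡ 2 (toℕ-head (b ⊕ one) (p ⊖1)) ⟩
        2 + toℕ (b ⊕ one)                         ≈⟨ +-congˡ 2 (toℕ-⊕one b) ⟩
        2 + (toℕ b + 1)                           ≡⟨ rearrange₂ (toℕ b) ⟩
        3 + toℕ b                                 ∎))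

module BlockIntersection {n : ℕ} where
  infix 4 _∈ᴮ_ _∉ᴮ_
  record _∈ᴮ_ (p : Point n) (B : Block n) : Set where
    constructor in-block
    field ∈?≡true : p ∈? B ≡ true

  record _∉ᴮ_ (p : Point n) (B : Block n) : Set where
    constructor not-in-block
    field ∈?≡false : p ∈? B ≡ false

  ∈ᴮ-first : ∀ {x y z} → x ∈ᴮ (x , y , z)
  ∈ᴮ-first {x} {y} {z} = in-block x∈?
    where
    x∈? : x ∈? (x , y , z) ≡ true
    x∈? rewrite dec-true (x ≟P x) refl = refl

  ∈ᴮ-second : ∀ {x y z} → y ∈ᴮ (x , y , z)
  ∈ᴮ-second {x} {y} {z} = in-block y∈?
    where
    y∈? : y ∈? (x , y , z) ≡ true
    y∈? rewrite dec-true (y ≟P y) refl = ∨-zeroʳ (does (y ≟P x))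

  ∈ᴮ-third : ∀ {x y z} → z ∈ᴮ (x , y , z)
  ∈ᴮ-third {x} {y} {z} = in-block z∈?
    where
    z∈? : z ∈? (x , y , z) ≡ true
    z∈? rewrite dec-true (z ≟P z) refl | ∨-zeroʳ (does (z ≟P y)) = ∨-zeroʳ (does (z ≟P x))

  ∉ᴮ-intro : ∀ {p x y z} → p ≢ x → p ≢ y → p ≢ z → p ∉ᴮ (x , y , z)
  ∉ᴮ-intro {p} {x} {y} {z} p≢x p≢y p≢z = not-in-block p∉?
    where
    p∉? : p ∈? (x , y , z) ≡ false
    p∉? rewrite dec-false (p ≟P x) p≢x | dec-false (p ≟P y) p≢y | dec-false (p ≟P z) p≢z = refl

  -- A record rather than Adjacent itself, whose reduction would hide the blocks from unification.
  infix 4 _∼_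
  record _∼_ (B B' : Block n) : Set where
    constructor adjacent
    field ∼⇒Adjacent : Adjacent B B'

  shares₁₂ : ∀ {x y z B} → x ∈ᴮ B → y ∈ᴮ B → z ∉ᴮ B → (x , y , z) ∼ B
  shares₁₂ {x} {y} {z} {B} (in-block x∈) (in-block y∈) (not-in-block z∉) = adjacent common≡2
    where
    common≡2 : Adjacent (x , y , z) B
    common≡2 rewrite x∈ | y∈ | z∉ = refl

  shares₁₃ : ∀ {x y z B} → x ∈ᴮ B → y ∉ᴮ B → z ∈ᴮ B → (x , y , z) ∼ B
  shares₁₃ {x} {y} {z} {B} (in-block x∈) (not-in-block y∉) (in-block z∈) = adjacent common≡2
    where
    common≡2 : Adjacent (x , y , z) B
    common≡2 rewrite x∈ | y∉ | z∈ = refl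

  shares₂₃ : ∀ {x y z B} → x ∉ᴮ B → y ∈ᴮ B → z ∈ᴮ B → (x , y , z) ∼ B
  shares₂₃ {x} {y} {z} {B} (not-in-block x∉) (in-block y∈) (in-block z∈) = adjacent common≡2
    where
    common≡2 : Adjacent (x , y , z) B
    common≡2 rewrite x∉ | y∈ | z∈ = refl

  pt≢ˡ : ∀ {a b : Fin n} {e f} → a ≢ b → pt a e ≢ pt b f
  pt≢ˡ a≢b refl = a≢b refl

  pt≢ʳ : ∀ {a b : Fin n} {e f} → e ≢ f → pt a e ≢ pt b f
  pt≢ʳ e≢f refl = e≢f refl

  Distinct : Block n → Set
  Distinct (x , y , z) = x ≢ y × x ≢ z × y ≢ z

  private
    [_≟_] : Point n → Point n → ℕ
    [ p ≟ q ] = ind (does (p ≟P q))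

    [≟]-sym : ∀ p q → [ p ≟ q ] ≡ [ q ≟ p ]
    [≟]-sym p q with p ≟P q | q ≟P p
    ... | yes _   | yes _   = refl
    ... | no _    | no _    = refl
    ... | yes p≡q | no q≢p  = ⊥-elim (q≢p (sym p≡q))
    ... | no p≢q  | yes q≡p = ⊥-elim (p≢q (sym q≡p))

    ind-∈? : ∀ p {x y z} → Distinct (x , y , z) → ind (p ∈? (x , y , z)) ≡ [ p ≟ x ] + [ p ≟ y ] + [ p ≟ z ]
    ind-∈? p {x} {y} {z} (x≢y , x≢z , y≢z) with p ≟P x | p ≟P y | p ≟P z
    ... | yes _   | no _    | no _    = refl
    ... | no _    | yes _   | no _    = refl
    ... | no _    | no _    | yes _   = refl
    ... | no _    | no _    | no _    = refl
    ... | yes p≡x | yes p≡y | _       = ⊥-elim (x≢y (trans (sym p≡x) p≡y))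
    ... | yes p≡x | no _    | yes p≡z = ⊥-elim (x≢z (trans (sym p≡x) p≡z))
    ... | no _    | yes p≡y | yes p≡z = ⊥-elim (y≢z (trans (sym p≡y) p≡z))

  common-sym : ∀ B B' → Distinct B → Distinct B' → common B B' ≡ common B' B
  common-sym (x₁ , x₂ , x₃) (y₁ , y₂ , y₃) dB dB'
    rewrite ind-∈? x₁ dB' | ind-∈? x₂ dB' | ind-∈? x₃ dB' | ind-∈? y₁ dB | ind-∈? y₂ dB | ind-∈? y₃ dB
          | [≟]-sym y₁ x₁ | [≟]-sym y₁ x₂ | [≟]-sym y₁ x₃
          | [≟]-sym y₂ x₁ | [≟]-sym y₂ x₂ | [≟]-sym y₂ x₃
          | [≟]-sym y₃ x₁ | [≟]-sym y₃ x₂ | [≟]-sym y₃ x₃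
    = transpose [ x₁ ≟ y₁ ] [ x₁ ≟ y₂ ] [ x₁ ≟ y₃ ]
                [ x₂ ≟ y₁ ] [ x₂ ≟ y₂ ] [ x₂ ≟ y₃ ]
                [ x₃ ≟ y₁ ] [ x₃ ≟ y₂ ] [ x₃ ≟ y₃ ]
    where
    transpose : ∀ a b c d e f g h i →
      (a + b + c) + (d + e + f) + (g + h + i) ≡ (a + d + g) + (b + e + h) + (c + f + i)
    transpose = solve-∀

  Adjacent-sym : ∀ {B B'} → Distinct B → Distinct B' → Adjacent B B' → Adjacent B' B
  Adjacent-sym {B} {B'} dB dB' adj = trans (common-sym B' B dB' dB) adj

module WalkProperties {n : ℕ} (V : Block n → Set) (distinct : ∀ {B} → V B → BlockIntersection.Distinct B) where
  open BlockIntersection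
  _++ᵂ_ : ∀ {A B C} → Walk V A B → Walk V B C → Walk V A C
  stop ++ᵂ w' = w'
  step v adj w ++ᵂ w' = step v adj (w ++ᵂ w')

  reverse : ∀ {A B} → V A → Walk V A B → Walk V B A
  reverse vA stop = stop
  reverse vA (step v adj w) = reverse v w ++ᵂ step vA (Adjacent-sym (distinct vA) (distinct v) adj) stop

module _ (m : ℕ) where
  open Modular m

  -- No validity is assumed of the colourings c₀, c₁: any colouring gives a connected graph.
  module Connectivity {K J : ℕ} (3*K≋1 : 3 * K ≋ 1) (N≡2*J+1 : N ≡ 2 * J + 1)
                      (g : Fin N) (c₀ c₁ : Fin N → Bool) where
    open CoprimeToSix {K} {J} 3*K≋1 N≡2*J+1
    open BlockIntersection

    SBlock-distinct : ∀ {c : Fin N → Bool} {b : Fin N} {B : Block N} → SBlock c b B → Distinct B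
    SBlock-distinct {b = b} (s1c-i h h≢0)   = pt≢ˡ (tail≢head b h≢0) , pt≢ʳ (λ ()) , pt≢ˡ (≢-sym (tail≢head b h≢0))
    SBlock-distinct {b = b} (s1c-ii h h≢0)  = pt≢ˡ (tail≢head b h≢0) , pt≢ʳ (λ ()) , pt≢ˡ (≢-sym (tail≢head b h≢0))
    SBlock-distinct {b = b} (s2a-1 h h≢0 _) = (λ ()) , (λ ()) , pt≢ˡ (tail≢head b h≢0)
    SBlock-distinct {b = b} (s2a-2 h h≢0 _) = (λ ()) , (λ ()) , pt≢ˡ (tail≢head b h≢0)
    SBlock-distinct {b = b} (s2a-3 h h≢0 _) = (λ ()) , (λ ()) , pt≢ˡ (tail≢head b h≢0)
    SBlock-distinct {b = b} (s2a-4 h h≢0 _) = (λ ()) , (λ ()) , pt≢ˡ (tail≢head b h≢0)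
    SBlock-distinct {b = b} (s2b-1 h h≢0 _) = (λ ()) , (λ ()) , pt≢ˡ (tail≢head b h≢0)
    SBlock-distinct {b = b} (s2b-2 h h≢0 _) = (λ ()) , (λ ()) , pt≢ˡ (tail≢head b h≢0)
    SBlock-distinct {b = b} (s2b-3 h h≢0 _) = (λ ()) , (λ ()) , pt≢ˡ (tail≢head b h≢0)
    SBlock-distinct {b = b} (s2b-4 h h≢0 _) = (λ ()) , (λ ()) , pt≢ˡ (tail≢head b h≢0)
    SBlock-distinct s3-1 = (λ ()) , (λ ()) , (λ ())
    SBlock-distinct s3-2 = (λ ()) , (λ ()) , (λ ())
    SBlock-distinct s3-3 = (λ ()) , (λ ()) , pt≢ʳ (λ ())
    SBlock-distinct s3-4 = (λ ()) , (λ ()) , pt≢ʳ (λ ())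

    g′ : Fin N
    g′ = g ⊕ one

    V : Block N → Set
    V B = SBlock c₀ g B ⊎ SBlock c₁ g′ B

    V-distinct : ∀ {B} → V B → Distinct B
    V-distinct (inj₁ S) = SBlock-distinct S
    V-distinct (inj₂ S) = SBlock-distinct S

    open WalkProperties V V-distinct

    hub : Block N
    hub = (inf false , inf true , pt g false)

    Reaches : Block N → Set
    Reaches B = Walk V B hub

    reaches-via : ∀ {B B'} → V B' → B ∼ B' → Reaches B' → Reaches B
    reaches-via vB' (adjacent adj) = step vB' adj

    ∼⇒⇔ : ∀ {B B'} → V B → V B' → B ∼ B' → Reaches B ⇔ Reaches B'
    ∼⇒⇔ vB vB' (adjacent adj) = mk⇔ (step vB (Adjacent-sym (V-distinct vB) (V-distinct vB') adj)) (step vB' adj)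

    module Schreiber (c : Fin N → Bool) (b : Fin N) (ι : ∀ {B} → SBlock c b B → V B) where
      arc₁ arc₂ : Fin N → Block N
      arc₁ h = (pt (tail b h) false , pt (head b h) false , pt (tail b h) true)
      arc₂ h = (pt (tail b h) false , pt (head b h) true , pt (tail b h) true)

      -- Vacuous for h = 0, which indexes no arc of D′_b.
      ArcReaches : Fin N → Set
      ArcReaches h = toℕ h ≢ 0 → Reaches (arc₁ h)

      module Arc {h : Fin N} (h≢0 : toℕ h ≢ 0) where
        private
          t≢d : tail b h ≢ head b h
          t≢d = tail≢head b h≢0

        arc₁∼∞-block : ∀ x e → arc₁ h ∼ (inf x , pt (tail b h) e , pt (head b h) false)
        arc₁∼∞-block x false = shares₁₂ ∈ᴮ-second ∈ᴮ-third (∉ᴮ-intro (λ ()) (pt≢ʳ (λ ())) (pt≢ˡ t≢d))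
        arc₁∼∞-block x true  = shares₂₃ (∉ᴮ-intro (λ ()) (pt≢ʳ (λ ())) (pt≢ˡ t≢d)) ∈ᴮ-third ∈ᴮ-second

        arc₂∼∞-block : ∀ x e → arc₂ h ∼ (inf x , pt (tail b h) e , pt (head b h) true)
        arc₂∼∞-block x false = shares₁₂ ∈ᴮ-second ∈ᴮ-third (∉ᴮ-intro (λ ()) (pt≢ʳ (λ ())) (pt≢ˡ t≢d))
        arc₂∼∞-block x true  = shares₂₃ (∉ᴮ-intro (λ ()) (pt≢ʳ (λ ())) (pt≢ˡ t≢d)) ∈ᴮ-third ∈ᴮ-second

        arc₁∼arc₂ : arc₁ h ∼ arc₂ h
        arc₁∼arc₂ = shares₁₃ ∈ᴮ-first (∉ᴮ-intro (pt≢ˡ (≢-sym t≢d)) (pt≢ʳ (λ ())) (pt≢ˡ (≢-sym t≢d))) ∈ᴮ-third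

        arc₁⇔arc₂ : Reaches (arc₁ h) ⇔ Reaches (arc₂ h)
        arc₁⇔arc₂ = ∼⇒⇔ (ι (s1c-i h h≢0)) (ι (s1c-ii h h≢0)) arc₁∼arc₂

        arc₁⇔∞-block : ∀ {x e f} → SBlock c b (inf x , pt (tail b h) e , pt (head b h) f) →
                       Reaches (arc₁ h) ⇔ Reaches (inf x , pt (tail b h) e , pt (head b h) f)
        arc₁⇔∞-block {x} {e} {false} S = ∼⇒⇔ (ι (s1c-i h h≢0)) (ι S) (arc₁∼∞-block x e)
        arc₁⇔∞-block {x} {e} {true}  S = ⇔-trans arc₁⇔arc₂ (∼⇒⇔ (ι (s1c-ii h h≢0)) (ι S) (arc₂∼∞-block x e))

        ∞₀-tail-block : Σ Bool λ f → SBlock c b (inf false , pt (tail b h) false , pt (head b h) f)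
        ∞₀-tail-block with c h in colour
        ... | true  = false , s2a-1 h h≢0 colour
        ... | false = true  , s2b-3 h h≢0 colour

        ∞₀-head-block : Σ Bool λ e → SBlock c b (inf false , pt (tail b h) e , pt (head b h) false)
        ∞₀-head-block with c h in colour
        ... | true  = false , s2a-1 h h≢0 colour
        ... | false = true  , s2b-4 h h≢0 colour

      open Arc public

      SBlock-reaches : (∀ h → ArcReaches h) → Reaches (inf false , inf true , pt b false) →
                       ∀ {B} → SBlock c b B → Reaches B
      SBlock-reaches arcs ∞∞b (s1c-i h h≢0)      = arcs h h≢0
      SBlock-reaches arcs ∞∞b (s1c-ii h h≢0)     = Equivalence.to (arc₁⇔arc₂ h≢0) (arcs h h≢0)
      SBlock-reaches arcs ∞∞b S@(s2a-1 h h≢0 _) = Equivalence.to (arc₁⇔∞-block h≢0 S) (arcs h h≢0)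
      SBlock-reaches arcs ∞∞b S@(s2a-2 h h≢0 _) = Equivalence.to (arc₁⇔∞-block h≢0 S) (arcs h h≢0)
      SBlock-reaches arcs ∞∞b S@(s2a-3 h h≢0 _) = Equivalence.to (arc₁⇔∞-block h≢0 S) (arcs h h≢0)
      SBlock-reaches arcs ∞∞b S@(s2a-4 h h≢0 _) = Equivalence.to (arc₁⇔∞-block h≢0 S) (arcs h h≢0)
      SBlock-reaches arcs ∞∞b S@(s2b-1 h h≢0 _) = Equivalence.to (arc₁⇔∞-block h≢0 S) (arcs h h≢0)
      SBlock-reaches arcs ∞∞b S@(s2b-2 h h≢0 _) = Equivalence.to (arc₁⇔∞-block h≢0 S) (arcs h h≢0)
      SBlock-reaches arcs ∞∞b S@(s2b-3 h h≢0 _) = Equivalence.to (arc₁⇔∞-block h≢0 S) (arcs h h≢0)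
      SBlock-reaches arcs ∞∞b S@(s2b-4 h h≢0 _) = Equivalence.to (arc₁⇔∞-block h≢0 S) (arcs h h≢0)
      SBlock-reaches arcs ∞∞b s3-1 = ∞∞b
      SBlock-reaches arcs ∞∞b s3-2 =
        reaches-via (ι s3-1) (shares₁₂ ∈ᴮ-first ∈ᴮ-second (∉ᴮ-intro (λ ()) (λ ()) (pt≢ʳ (λ ())))) ∞∞b
      SBlock-reaches arcs ∞∞b s3-3 =
        reaches-via (ι s3-1) (shares₁₂ ∈ᴮ-first ∈ᴮ-third (∉ᴮ-intro (λ ()) (λ ()) (pt≢ʳ (λ ())))) ∞∞b
      SBlock-reaches arcs ∞∞b s3-4 =
        reaches-via (ι s3-1) (shares₁₂ ∈ᴮ-second ∈ᴮ-third (∉ᴮ-intro (λ ()) (λ ()) (pt≢ʳ (λ ())))) ∞∞b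

      arc₁⇔arc₁-−2· : {h : Fin N} (h≢0 : toℕ h ≢ 0) → Reaches (arc₁ h) ⇔ Reaches (arc₁ (−2· h))
      arc₁⇔arc₁-−2· {h} h≢0 with ∞₀-head-block h≢0 | ∞₀-tail-block (−2·-≢0 h≢0)
      ... | e , X | f , Y =
        ⇔-trans (arc₁⇔∞-block h≢0 X) (⇔-trans (∼⇒⇔ (ι X) (ι Y) X∼Y) (⇔-sym (arc₁⇔∞-block (−2·-≢0 h≢0) Y)))
        where
        X∼Y : (inf false , pt (tail b h) e , pt (head b h) false) ∼ (inf false , pt (head b h) false , pt (head b (−2· h)) f)
        X∼Y = shares₁₃ ∈ᴮ-first (∉ᴮ-intro (λ ()) (pt≢ˡ (tail≢head b h≢0)) (pt≢ˡ (tail≢head-−2· b h≢0))) ∈ᴮ-second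

      ArcReaches-−2· : ∀ h → ArcReaches h ⇔ ArcReaches (−2· h)
      ArcReaches-−2· h = mk⇔
        (λ arc −2h≢0 → Equivalence.to (arc₁⇔arc₁-−2· (−2·≢0⇒≢0 {h} −2h≢0)) (arc (−2·≢0⇒≢0 −2h≢0)))
        (λ arc h≢0 → Equivalence.from (arc₁⇔arc₁-−2· h≢0) (arc (−2·-≢0 h≢0)))

    module S₀ = Schreiber c₀ g  inj₁
    module S₁ = Schreiber c₁ g′ inj₂

    arc₁⇔arc₁-⊖1 : {p : Fin N} (p≢0 : toℕ p ≢ 0) (p⊖1≢0 : toℕ (p ⊖1) ≢ 0) →
                   Reaches (S₀.arc₁ p) ⇔ Reaches (S₁.arc₁ (p ⊖1))
    arc₁⇔arc₁-⊖1 {p} p≢0 p⊖1≢0 with S₀.∞₀-tail-block p≢0 | S₁.∞₀-tail-block p⊖1≢0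
    ... | f , X | f′ , Y =
      ⇔-trans (S₀.arc₁⇔∞-block p≢0 X) (⇔-trans (∼⇒⇔ (inj₁ X) (inj₂ Y) X∼Y) (⇔-sym (S₁.arc₁⇔∞-block p⊖1≢0 Y)))
      where
      Y′ : Block N
      Y′ = (inf false , pt (tail g′ (p ⊖1)) false , pt (head g′ (p ⊖1)) f′)
      same-tail : tail g′ (p ⊖1) ≡ tail g p
      same-tail = tail-⊕one-⊖1 g p
      X∼Y : (inf false , pt (tail g p) false , pt (head g p) f) ∼ Y′
      X∼Y = shares₁₂ ∈ᴮ-first (subst (λ t → pt t false ∈ᴮ Y′) same-tail ∈ᴮ-second)
        (∉ᴮ-intro (λ ())
                  (pt≢ˡ (λ d≡t → tail≢head g p≢0 (sym (trans d≡t same-tail))))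
                  (pt≢ˡ (head≢head-⊕one-⊖1 g p≢0)))

    ArcPairReaches : Fin N → Set
    ArcPairReaches r = S₀.ArcReaches r × S₁.ArcReaches (r ⊖1)

    ArcPairReaches-fz : ArcPairReaches fz
    ArcPairReaches-fz = (λ 0≢0 → ⊥-elim (0≢0 refl)) , arc-fz⊖1
      where
      arc-fz⊖1 : S₁.ArcReaches (fz ⊖1)
      arc-fz⊖1 k≢0 with S₁.∞₀-tail-block k≢0
      ... | f , Y = Equivalence.from (S₁.arc₁⇔∞-block k≢0 Y) (reaches-via (inj₁ s3-1) Y∼hub stop)
        where
        tail≡g : tail g′ (fz ⊖1) ≡ g
        tail≡g = trans (tail-⊕one-⊖1 g fz) (toℕ-≋-injective (toℕ-⊕ fz g))
        Y∼hub : (inf false , pt (tail g′ (fz ⊖1)) false , pt (head g′ (fz ⊖1)) f) ∼ hub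
        Y∼hub = shares₁₂ ∈ᴮ-first (subst (λ t → pt t false ∈ᴮ hub) (sym tail≡g) ∈ᴮ-third)
          (∉ᴮ-intro (λ ()) (λ ()) (pt≢ˡ (λ d≡g → tail≢head g′ k≢0 (trans tail≡g (sym d≡g)))))

    module _ (r : Fin N) (arc-r : S₀.ArcReaches r) (arc-r⊖1 : S₁.ArcReaches (r ⊖1)) where
      private
        q : Fin N
        q = −½· r

        arc-q : S₀.ArcReaches q
        arc-q = Equivalence.from (S₀.ArcReaches-−2· q) (subst S₀.ArcReaches (sym (−2·−½· r)) arc-r)

      ArcPairReaches-⊕three-if-q≡one : q ≡ one → ArcPairReaches (r ⊕ three)
      ArcPairReaches-⊕three-if-q≡one q≡one =
        subst S₀.ArcReaches (trans q≡one (sym r⊕three≡one)) arc-q ,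
        λ r⊕three⊖1≢0 →
          ⊥-elim (r⊕three⊖1≢0 (subst (λ x → toℕ (x ⊖1) ≡ 0) (sym r⊕three≡one) one⊖1≡0))
        where
        r⊕three≡one : r ⊕ three ≡ one
        r⊕three≡one = trans (cong (_⊕ three) (trans (sym (−2·−½· r)) (cong −2·_ q≡one))) −2·one⊕three

      ArcPairReaches-⊕three-if-q≢one : q ≢ one → ArcPairReaches (r ⊕ three)
      ArcPairReaches-⊕three-if-q≢one q≢one = arc-r⊕three , arc-r⊕three⊖1
        where
        q⊖1≢0 : toℕ (q ⊖1) ≢ 0
        q⊖1≢0 q⊖1≡0 = q≢one (⊖1≡0⇒≡one q⊖1≡0)
        arc-q⊖1 : S₁.ArcReaches (q ⊖1)
        arc-q⊖1 with toℕ q ≟ℕ 0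
        ... | yes q≡0 = subst (λ x → S₁.ArcReaches (x ⊖1)) r≡q arc-r⊖1
          where
          r≡q : r ≡ q
          r≡q = toℕ-injective (trans (cong toℕ (sym (−2·−½· r))) (trans (−2·-≡0 q≡0) (sym q≡0)))
        ... | no q≢0 = λ _ → Equivalence.to (arc₁⇔arc₁-⊖1 q≢0 q⊖1≢0) (arc-q q≢0)
        −2·[q⊖1]≡r⊕three⊖1 : −2· (q ⊖1) ≡ (r ⊕ three) ⊖1
        −2·[q⊖1]≡r⊕three⊖1 = trans (−2·-⊖1 q) (cong (λ x → (x ⊕ three) ⊖1) (−2·−½· r))
        arc-r⊕three⊖1 : S₁.ArcReaches ((r ⊕ three) ⊖1)
        arc-r⊕three⊖1 =
          subst S₁.ArcReaches −2·[q⊖1]≡r⊕three⊖1 (Equivalence.to (S₁.ArcReaches-−2· (q ⊖1)) arc-q⊖1)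
        arc-r⊕three : S₀.ArcReaches (r ⊕ three)
        arc-r⊕three r⊕three≢0 =
          Equivalence.from (arc₁⇔arc₁-⊖1 r⊕three≢0 r⊕three⊖1≢0) (arc-r⊕three⊖1 r⊕three⊖1≢0)
          where
          r⊕three⊖1≢0 : toℕ ((r ⊕ three) ⊖1) ≢ 0
          r⊕three⊖1≢0 = subst (λ x → toℕ x ≢ 0) −2·[q⊖1]≡r⊕three⊖1 (−2·-≢0 q⊖1≢0)

    ArcPairReaches-⊕three : ∀ r → ArcPairReaches r → ArcPairReaches (r ⊕ three)
    ArcPairReaches-⊕three r (arc-r , arc-r⊖1) with −½· r ≟ one
    ... | yes q≡one = ArcPairReaches-⊕three-if-q≡one r arc-r arc-r⊖1 q≡one
    ... | no q≢one  = ArcPairReaches-⊕three-if-q≢one r arc-r arc-r⊖1 q≢one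

    all-ArcPairReaches : ∀ r → ArcPairReaches r
    all-ArcPairReaches = stride-induction ArcPairReaches three K (≋-trans (*-cong (toℕ-mod 3) (≋-refl {K})) 3*K≋1)
      ArcPairReaches-fz ArcPairReaches-⊕three

    ∞∞g′-reaches : Reaches (inf false , inf true , pt g′ false)
    ∞∞g′-reaches with g′ ≟ g
    ... | yes g′≡g = subst (λ x → Reaches (inf false , inf true , pt x false)) (sym g′≡g) stop
    ... | no g′≢g  =
      reaches-via (inj₁ s3-1) (shares₁₂ ∈ᴮ-first ∈ᴮ-second (∉ᴮ-intro (λ ()) (λ ()) (pt≢ˡ g′≢g))) stop

    V-reaches : ∀ {B} → V B → Reaches B
    V-reaches (inj₁ S) = S₀.SBlock-reaches (λ h → proj₁ (all-ArcPairReaches h)) stop S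
    V-reaches (inj₂ S) = S₁.SBlock-reaches arcs ∞∞g′-reaches S
      where
      arcs : ∀ k → S₁.ArcReaches k
      arcs k = subst S₁.ArcReaches (⊕one⊖1 k) (proj₂ (all-ArcPairReaches (k ⊕ one)))

    connected : Connected V
    connected B B' vB vB' = V-reaches vB ++ᵂ reverse vB' (V-reaches vB')

lemma9 : (n : ℕ) .{{_ : NonZero n}} → (n % 6 ≡ 1 ⊎ n % 6 ≡ 5) →
         (g : Fin n) → (c₀ c₁ : Fin n → Bool) →
         ValidColouring c₀ → ValidColouring c₁ →
         Connected (λ B → SBlock c₀ g B ⊎ SBlock c₁ (g ⊕ one) B)
lemma9 (suc m) N%6 g c₀ c₁ _ _ with Modular.3-invertible×odd m N%6
... | (K , 3*K≋1) , (J , N≡2*J+1) = Connectivity.connected m {K} {J} 3*K≋1 N≡2*J+1 g c₀ c₁
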